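{- Every connected graph $G$ (loops and multiple edges allowed) has an orientable cellular embedding in which there is a face $f$ whose boundary contains every edge of $G$, and whose genus equals the maximum orientable genus of $G$.
   Context: Embeddings are cellular embeddings in closed orientable surfaces; the maximum orientable genus of $G$ is the largest genus of an orientable surface in which $G$ has a cellular embedding. -}

module Defs where

open import Data.Nat using (ℕ; zero; suc; _+_; _*_; _∸_; _≤_; _≤ᵇ_)
open import Data.Nat.DivMod using (_/_)
open import Data.Fin using (Fin; toℕ)
open import Data.Bool using (Bool; true; false; not; if_then_else_)
open import Data.List using (List; []; _∷_; allFin; concatMap; upTo)
open import Data.Bool using (_∧_)
open import Data.Product using (Σ; ∃; _×_; _,_; proj₁; proj₂)
open import Data.Sum using (_⊎_)
open import Relation.Binary.PropositionalEquality using (_≡_)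

record Graph : Set where
  field
    V    : ℕ
    E    : ℕ
    ends : Fin E → Fin V × Fin V
open Graph public

data Reach (G : Graph) (u : Fin (V G)) : Fin (V G) → Set where
  here : Reach G u u
  fwd  : (e : Fin (E G)) → Reach G u (proj₁ (ends G e)) → Reach G u (proj₂ (ends G e))
  bwd  : (e : Fin (E G)) → Reach G u (proj₂ (ends G e)) → Reach G u (proj₁ (ends G e))

Connected : Graph → Set
Connected G = Fin (V G) × (∀ u v → Reach G u v)

-- Darts (half-edges): (e , false) is the half of e at its first end,
-- (e , true) the half at its second end.
Dart : Graph → Set
Dart G = Fin (E G) × Bool

tail : (G : Graph) → Dart G → Fin (V G)
tail G (e , false) = proj₁ (ends G e)
tail G (e , true)  = proj₂ (ends G e)

θ : (G : Graph) → Dart G → Dart G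
θ G (e , b) = (e , not b)

iter : {A : Set} → (A → A) → ℕ → A → A
iter f zero    x = x
iter f (suc k) x = f (iter f k x)

-- A rotation system: a permutation ρ of the darts whose cycles are exactly
-- the sets of darts at each vertex (a cyclic order around every vertex).
-- By the Heffter–Edmonds–Ringel rotation principle these correspond exactly
-- to orientable cellular embeddings of G (up to equivalence).
record RotationSystem (G : Graph) : Set where
  field
    ρ       : Dart G → Dart G
    ρ⁻¹     : Dart G → Dart G
    inv₁    : ∀ d → ρ (ρ⁻¹ d) ≡ d
    inv₂    : ∀ d → ρ⁻¹ (ρ d) ≡ d
    ρ-tail  : ∀ d → tail G (ρ d) ≡ tail G d
    ρ-trans : ∀ d d' → tail G d ≡ tail G d' → ∃ λ k → iter ρ k d ≡ d'
open RotationSystem public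

-- face-tracing permutation; faces of the embedding = orbits of φ
φ : {G : Graph} → RotationSystem G → Dart G → Dart G
φ {G} R d = ρ R (θ G d)

allDarts : (G : Graph) → List (Dart G)
allDarts G = concatMap (λ e → (e , false) ∷ (e , true) ∷ []) (allFin (E G))

key : {G : Graph} → Dart G → ℕ
key (e , b) = 2 * toℕ e + (if b then 1 else 0)

allB : {A : Set} → (A → Bool) → List A → Bool
allB p []       = true
allB p (x ∷ xs) = p x ∧ allB p xs

-- d is the key-minimal dart of its φ-orbit (orbits have size ≤ 2E)
isRep : {G : Graph} → RotationSystem G → Dart G → Bool
isRep {G} R d = allB (λ k → key {G} d ≤ᵇ key {G} (iter (φ R) k d)) (upTo (2 * E G))

countTrue : {A : Set} → (A → Bool) → List A → ℕ
countTrue p []       = 0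
countTrue p (x ∷ xs) = (if p x then 1 else 0) + countTrue p xs

-- number of faces: number of φ-orbits; the edgeless graph (a single vertex)
-- embeds in the sphere with exactly one face.
faces : {G : Graph} → RotationSystem G → ℕ
faces {G} R with E G
... | zero  = 1
... | suc _ = countTrue (isRep R) (allDarts G)

-- genus from Euler's formula V − E + F = 2 − 2g
genus : {G : Graph} → RotationSystem G → ℕ
genus {G} R = (2 + E G ∸ (V G + faces R)) / 2

IsMaxGenus : (G : Graph) → ℕ → Set
IsMaxGenus G g = (∃ λ (R : RotationSystem G) → genus R ≡ g)
               × (∀ (R : RotationSystem G) → genus R ≤ g)

-- some face (φ-orbit of a dart d₀) has every edge on its boundary
-- (for the edgeless graph the unique face trivially qualifies)
HasFaceWithAllEdges : {G : Graph} → RotationSystem G → Set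
HasFaceWithAllEdges {G} R =
  E G ≡ 0 ⊎ (∃ λ (d₀ : Dart G) → ∀ (e : Fin (E G)) →
              ∃ λ (b : Bool) → ∃ λ (k : ℕ) → iter (φ R) k d₀ ≡ (e , b))

{-# OPTIONS --safe #-}
-- Take a rotation system of maximum genus, i.e. with the fewest faces, and let F be the face
-- of a dart d₀. While some edge misses F, connectivity yields a dart x whose edge misses F
-- although F passes through its vertex, at a dart z. Moving x in the rotation at that vertex
-- to sit right after y = ρ⁻¹ z (with p = ρ⁻¹ x) composes the face permutation φ with the
-- transpositions (θp θx) and (θy θx). Faces are cycles of φ, and composing with (a b) merges
-- the cycles of a and b if they differ and otherwise splits one cycle in two. The first
-- transposition adds at most one face and leaves F untouched, as θp and θx are off F; the
-- second then merges F with the face of θx. So the number of faces does not grow while F keeps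
-- its darts and gains the edge of x; after at most E steps F carries every edge, and the genus,
-- which cannot have dropped, is still the maximum.
module Submission where

open import Defs
open import Data.Bool using (Bool; true; false; not; if_then_else_; T)
open import Data.Bool.Properties using (not-involutive)
open import Data.Empty using (⊥-elim)
open import Data.Fin using (Fin; toℕ; fromℕ<; combine) renaming (zero to fzero; suc to fsuc)
open import Data.Fin.Properties
  using (pigeonhole; any?; toℕ<n; toℕ-injective; toℕ-fromℕ<; toℕ-combine; combine-injective)
open import Data.List using (List; []; _∷_; allFin; concatMap; upTo; length)
open import Data.List.Membership.Propositional using (_∈_)
open import Data.List.Membership.Propositional.Properties using (∈-upTo⁺; ∈-allFin)
open import Data.List.Properties using (length-tabulate)
open import Data.List.Relation.Unary.All using (All; []; _∷_)
import Data.List.Relation.Unary.All as All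
open import Data.List.Relation.Unary.AllPairs using ([]; _∷_)
open import Data.List.Relation.Unary.Any using (here; there)
open import Data.List.Relation.Unary.Unique.Propositional using (Unique)
open import Data.List.Relation.Unary.Unique.Propositional.Properties using (allFin⁺)
open import Data.Nat using (ℕ; zero; suc; _+_; _*_; _∸_; _≤_; _<_; _≤ᵇ_; z≤n; s≤s; s≤s⁻¹)
open import Data.Nat.DivMod using (_/_; _%_; m≡m%n+[m/n]*n; m%n<n; /-monoˡ-≤)
open import Data.Nat.Properties renaming (_≟_ to _≟ℕ_)
open import Data.Product using (∃; _×_; _,_; proj₁; proj₂)
open import Data.Sum using (_⊎_; inj₁; inj₂; [_,_]′)
import Data.Sum as Sum
open import Data.Unit using (tt)
open import Function using (_∘_; id; _⇔_; mk⇔; Equivalence)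
open import Function.Definitions using (Injective)
open import Relation.Binary.Definitions using (DecidableEquality)
open import Relation.Binary.PropositionalEquality
  using (_≡_; _≢_; refl; sym; trans; cong; subst; module ≡-Reasoning)
open import Relation.Nullary using (¬_; Dec; yes; no; does; contradiction)
open import Relation.Nullary.Decidable using (map′; _⊎-dec_; ¬?; decidable-stable; dec-true; dec-false)

module Iteration {A : Set} where
  open ≡-Reasoning

  private variable
    σ τ : A → A
    a b c w z : A

  Orb : (A → A) → A → A → Set
  Orb σ a b = ∃ λ k → iter σ k a ≡ b

  iter-+ : ∀ j k → iter σ (j + k) a ≡ iter σ j (iter σ k a)
  iter-+ zero k = refl
  iter-+ {σ = σ} (suc j) k = cong σ (iter-+ j k)

  iter-suc : ∀ k → iter σ (suc k) a ≡ iter σ k (σ a)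
  iter-suc zero = refl
  iter-suc {σ = σ} (suc k) = cong σ (iter-suc k)

  iter-injective : Injective _≡_ _≡_ σ → ∀ k → iter σ k a ≡ iter σ k b → a ≡ b
  iter-injective σ-inj zero eq = eq
  iter-injective σ-inj (suc k) eq = iter-injective σ-inj k (σ-inj eq)

  iter-periodic : ∀ {p} → iter σ p a ≡ a → ∀ q → iter σ (q * p) a ≡ a
  iter-periodic period zero = refl
  iter-periodic {σ = σ} {a = a} {p} period (suc q) = begin
    iter σ (p + q * p) a         ≡⟨ iter-+ p (q * p) ⟩
    iter σ p (iter σ (q * p) a)  ≡⟨ cong (iter σ p) (iter-periodic period q) ⟩
    iter σ p a                   ≡⟨ period ⟩
    a                            ∎

  iter-mod : ∀ {p} → iter σ (suc p) a ≡ a → ∀ k → iter σ k a ≡ iter σ (k % suc p) a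
  iter-mod {σ = σ} {a = a} {p} period k = begin
    iter σ k a
      ≡⟨ cong (λ n → iter σ n a) (m≡m%n+[m/n]*n k (suc p)) ⟩
    iter σ (k % suc p + k / suc p * suc p) a
      ≡⟨ iter-+ (k % suc p) (k / suc p * suc p) ⟩
    iter σ (k % suc p) (iter σ (k / suc p * suc p) a)
      ≡⟨ cong (iter σ (k % suc p)) (iter-periodic period (k / suc p)) ⟩
    iter σ (k % suc p) a
      ∎

  Orb-refl : Orb σ a a
  Orb-refl = 0 , refl

  Orb-trans : Orb σ a b → Orb σ b c → Orb σ a c
  Orb-trans (j , refl) (k , refl) = k + j , iter-+ k j

  Orb-invariant : (P : A → Set) → (∀ {w} → P w → P (σ w)) → P a → Orb σ a z → P z
  Orb-invariant P step Pa (zero , refl) = Pa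
  Orb-invariant P step Pa (suc k , refl) = step (Orb-invariant P step Pa (k , refl))

  Orb-preserves : ∀ {B : Set} (f : A → B) → (∀ w → f (σ w) ≡ f w) → Orb σ a z → f z ≡ f a
  Orb-preserves {σ = σ} {a = a} f preserved =
    Orb-invariant (λ w → f w ≡ f a) (λ {w} fw≡fa → trans (preserved w) fw≡fa) refl

  Orb-lift : (∀ w → Orb τ w (σ w)) → Orb σ a z → Orb τ a z
  Orb-lift {τ = τ} {a = a} step = Orb-invariant (Orb τ a) (λ {w} a→w → Orb-trans a→w (step w)) Orb-refl

  Orb-fixedPoint : Injective _≡_ _≡_ σ → σ b ≡ b → Orb σ a b → a ≡ b
  Orb-fixedPoint {σ = σ} {b = b} {a = a} σ-inj fixed a→b =
    Orb-invariant (λ w → w ≡ b → a ≡ b) (λ back σw≡b → back (σ-inj (trans σw≡b (sym fixed)))) id a→b refl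

  iter-agree : (∀ {w} → Orb σ a w → τ w ≡ σ w) → ∀ k → iter τ k a ≡ iter σ k a
  iter-agree agree zero = refl
  iter-agree {τ = τ} agree (suc k) = trans (cong τ (iter-agree agree k)) (agree (k , refl))

  Orb-agree : (∀ {w} → Orb σ a w → τ w ≡ σ w) → Orb σ a z ⇔ Orb τ a z
  Orb-agree agree = mk⇔ (λ (k , eq) → k , trans (iter-agree agree k) eq)
                        (λ (k , eq) → k , trans (sym (iter-agree agree k)) eq)

  first-hit : {P : A → Set} → (∀ w → Dec (P w)) → (∀ {w} → ¬ P w → τ w ≡ σ w) →
              Orb σ a z → P z → ∃ λ u → P u × Orb σ a u × Orb τ a u
  first-hit {τ = τ} {σ = σ} {z = z} {P = P} P? agree (k , eq) Pz = along k eq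
    where
    along : ∀ k {a} → iter σ k a ≡ z → ∃ λ u → P u × Orb σ a u × Orb τ a u
    along zero refl = _ , Pz , Orb-refl , Orb-refl
    along (suc k) {a} eq with P? a
    ... | yes Pa = a , Pa , Orb-refl , Orb-refl
    ... | no ¬Pa with along k (trans (sym (iter-suc k)) eq)
    ...   | u , Pu , σ-path , τ-path = u , Pu , Orb-trans (1 , refl) σ-path , Orb-trans (1 , agree ¬Pa) τ-path

open Iteration

module _ {A : Set} where
  private variable
    p q : A → Bool
    x : A
    xs : List A

  allB-true : allB p xs ≡ true → x ∈ xs → p x ≡ true
  allB-true {p = p} {xs = y ∷ xs} all-true x∈ with p y in py
  allB-true all-true (here refl) | true = py
  allB-true all-true (there x∈) | true = allB-true all-true x∈

  allB-false : allB p xs ≡ false → ∃ λ x → x ∈ xs × p x ≡ false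
  allB-false {p = p} {xs = y ∷ xs} some-false with p y in py
  ... | true = let x , x∈ , px = allB-false some-false in x , there x∈ , px
  ... | false = y , here refl , py

  indicator-mono : ∀ {b c} → (b ≡ true → c ≡ true) → (if b then 1 else 0) ≤ (if c then 1 else 0)
  indicator-mono {false} _ = z≤n
  indicator-mono {true} b⇒c rewrite b⇒c refl = ≤-refl

  countTrue-mono : ∀ xs → (∀ {x} → x ∈ xs → p x ≡ true → q x ≡ true) → countTrue p xs ≤ countTrue q xs
  countTrue-mono [] _ = z≤n
  countTrue-mono (x ∷ xs) p⇒q = +-mono-≤ (indicator-mono (p⇒q (here refl))) (countTrue-mono xs (p⇒q ∘ there))

  countTrue-< : (∀ {x} → p x ≡ true → q x ≡ true) → x ∈ xs → p x ≡ false → q x ≡ true →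
                countTrue p xs < countTrue q xs
  countTrue-< {xs = _ ∷ xs} p⇒q (here refl) px qx rewrite px | qx = s≤s (countTrue-mono xs (λ _ → p⇒q))
  countTrue-< p⇒q (there x∈) px qx = +-mono-≤-< (indicator-mono p⇒q) (countTrue-< p⇒q x∈ px qx)

  countTrue-≤-suc : {New : A → Set} → Unique xs → (∀ {x} → q x ≡ true → p x ≡ true ⊎ New x) →
                    (∀ {x y} → New x → New y → x ≡ y) → countTrue q xs ≤ suc (countTrue p xs)
  countTrue-≤-suc {xs = []} _ _ _ = z≤n
  countTrue-≤-suc {xs = x ∷ xs} {q = q} {p = p} (x∉xs ∷ unique) classify new-unique with q x in qx
  ... | false = ≤-trans (countTrue-≤-suc unique classify new-unique) (s≤s (m≤n+m _ _))
  ... | true with classify qx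
  ...   | inj₁ px rewrite px = s≤s (countTrue-≤-suc unique classify new-unique)
  ...   | inj₂ new-x = s≤s (≤-trans (countTrue-mono xs old) (m≤n+m _ _))
    where
    old : ∀ {y} → y ∈ xs → q y ≡ true → p y ≡ true
    old y∈ qy = [ id , (λ new-y → contradiction (new-unique new-x new-y) (All.lookup x∉xs y∈)) ]′ (classify qy)

  countTrue≤length : ∀ xs → countTrue p xs ≤ length xs
  countTrue≤length [] = z≤n
  countTrue≤length {p = p} (x ∷ xs) with p x
  ... | true = s≤s (countTrue≤length xs)
  ... | false = m≤n⇒m≤1+n (countTrue≤length xs)

≤ᵇ-true⇒≤ : ∀ {m n} → (m ≤ᵇ n) ≡ true → m ≤ n
≤ᵇ-true⇒≤ {m} {n} m≤ᵇn = ≤ᵇ⇒≤ m n (subst T (sym m≤ᵇn) tt)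

≤ᵇ-false⇒> : ∀ {m n} → (m ≤ᵇ n) ≡ false → n < m
≤ᵇ-false⇒> m≰ᵇn = ≰⇒> (λ m≤n → subst T m≰ᵇn (≤⇒≤ᵇ m≤n))

module FiniteOrbits {A : Set} (key : A → ℕ) (N : ℕ) (key<N : ∀ a → key a < N)
                    (key-injective : Injective _≡_ _≡_ key)
                    (elements : List A) (∈-elements : ∀ a → a ∈ elements) (elements-unique : Unique elements)
                    where
  open ≡-Reasoning

  private variable
    σ : A → A
    a b d w z : A

  _≟_ : DecidableEquality A
  a ≟ b = map′ key-injective (cong key) (key a ≟ℕ key b)

  code : A → Fin N
  code a = fromℕ< (key<N a)

  code-injective : Injective _≡_ _≡_ code
  code-injective {a} {b} same = key-injective (begin
    key a          ≡⟨ toℕ-fromℕ< (key<N a) ⟨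
    toℕ (code a)   ≡⟨ cong toℕ same ⟩
    toℕ (code b)   ≡⟨ toℕ-fromℕ< (key<N b) ⟩
    key b          ∎)

  period : Injective _≡_ _≡_ σ → ∀ a → ∃ λ p → iter σ (suc p) a ≡ a × suc p ≤ N
  period {σ} σ-inj a with pigeonhole (n<1+n N) (λ i → code (iter σ (toℕ i) a))
  ... | i , j , i<j , same = p , iter-injective σ-inj (toℕ i) returns , p<N
    where
    p : ℕ
    p = toℕ j ∸ suc (toℕ i)
    j≡i+p : toℕ j ≡ toℕ i + suc p
    j≡i+p = trans (sym (m+[n∸m]≡n i<j)) (sym (+-suc (toℕ i) p))
    returns : iter σ (toℕ i) (iter σ (suc p) a) ≡ iter σ (toℕ i) a
    returns = begin
      iter σ (toℕ i) (iter σ (suc p) a)  ≡⟨ iter-+ (toℕ i) (suc p) ⟨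
      iter σ (toℕ i + suc p) a           ≡⟨ cong (λ n → iter σ n a) j≡i+p ⟨
      iter σ (toℕ j) a                   ≡⟨ code-injective same ⟨
      iter σ (toℕ i) a                   ∎
    p<N : suc p ≤ N
    p<N = ≤-trans (m≤n+m (suc p) (toℕ i)) (≤-trans (≤-reflexive (sym j≡i+p)) (s≤s⁻¹ (toℕ<n j)))

  Orb-bounded : Injective _≡_ _≡_ σ → Orb σ a b → ∃ λ r → r < N × iter σ r a ≡ b
  Orb-bounded {a = a} σ-inj (k , refl) with period σ-inj a
  ... | p , back , p<N = k % suc p , <-≤-trans (m%n<n k (suc p)) p<N , sym (iter-mod back k)

  Orb-sym : Injective _≡_ _≡_ σ → Orb σ a b → Orb σ b a
  Orb-sym {σ} {a = a} σ-inj (k , refl) with period σ-inj a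
  ... | p , back , _ = k * p , (begin
    iter σ (k * p) (iter σ k a)  ≡⟨ iter-+ (k * p) k ⟨
    iter σ (k * p + k) a         ≡⟨ cong (λ n → iter σ n a) (trans (+-comm (k * p) k) (sym (*-suc k p))) ⟩
    iter σ (k * suc p) a         ≡⟨ iter-periodic back k ⟩
    a                            ∎)

  Orb-meet : Injective _≡_ _≡_ σ → Orb σ d a → Orb σ d b → Orb σ a b
  Orb-meet σ-inj d→a d→b = Orb-trans (Orb-sym σ-inj d→a) d→b

  Orb? : Injective _≡_ _≡_ σ → ∀ a b → Dec (Orb σ a b)
  Orb? {σ} σ-inj a b = map′ (λ (i , eq) → toℕ i , eq) within (any? (λ i → iter σ (toℕ i) a ≟ b))
    where
    within : Orb σ a b → ∃ λ (i : Fin N) → iter σ (toℕ i) a ≡ b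
    within a→b with Orb-bounded σ-inj a→b
    ... | r , r<N , eq = fromℕ< r<N , trans (cong (λ n → iter σ n a) (toℕ-fromℕ< r<N)) eq

  isLeast : (A → A) → A → Bool
  isLeast σ d = allB (λ k → key d ≤ᵇ key (iter σ k d)) (upTo N)

  least-≤ : Injective _≡_ _≡_ σ → isLeast σ d ≡ true → Orb σ d z → key d ≤ key z
  least-≤ σ-inj least d→z with Orb-bounded σ-inj d→z
  ... | r , r<N , refl = ≤ᵇ-true⇒≤ (allB-true least (∈-upTo⁺ r<N))

  smaller-in-orbit : isLeast σ d ≡ false → ∃ λ z → Orb σ d z × key z < key d
  smaller-in-orbit {σ} {d} not-least with allB-false {xs = upTo N} not-least
  ... | k , _ , fails = iter σ k d , (k , refl) , ≤ᵇ-false⇒> fails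

  least-intro : (∀ {z} → Orb σ d z → key d ≤ key z) → isLeast σ d ≡ true
  least-intro {σ} {d} lower with isLeast σ d in least
  ... | true = refl
  ... | false with smaller-in-orbit least
  ...   | z , d→z , z<d = contradiction (lower d→z) (<⇒≱ z<d)

  least-exists : ∀ a → ∃ λ r → Orb σ a r × isLeast σ r ≡ true
  least-exists {σ} a = descend N a (key<N a)
    where
    descend : ∀ n a → key a < n → ∃ λ r → Orb σ a r × isLeast σ r ≡ true
    descend (suc n) a a<n with isLeast σ a in least
    ... | true = a , Orb-refl , least
    ... | false with smaller-in-orbit least
    ...   | z , a→z , z<a with descend n z (<-≤-trans z<a (s≤s⁻¹ a<n))
    ...     | r , z→r , r-least = r , Orb-trans a→z z→r , r-least

  least-unique : Injective _≡_ _≡_ σ → isLeast σ a ≡ true → isLeast σ b ≡ true → Orb σ a b → a ≡ b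
  least-unique σ-inj a-least b-least a→b =
    key-injective (≤-antisym (least-≤ σ-inj a-least a→b) (least-≤ σ-inj b-least (Orb-sym σ-inj a→b)))

  orbitCount : (A → A) → ℕ
  orbitCount σ = countTrue (isLeast σ) elements

  -- Opaque because the conversion checker would otherwise unfold nested transpositions
  -- into exponentially many cases of _≟_.
  opaque
    transpose : A → A → A → A
    transpose a b d with d ≟ a | d ≟ b
    ... | yes _ | _ = b
    ... | no _ | yes _ = a
    ... | no _ | no _ = d

    transpose-a : ∀ a b → transpose a b a ≡ b
    transpose-a a b with a ≟ a | a ≟ b
    ... | yes _ | _ = refl
    ... | no a≢a | _ = contradiction refl a≢a

    transpose-b : ∀ a b → transpose a b b ≡ a
    transpose-b a b with b ≟ a | b ≟ b
    ... | yes b≡a | _ = b≡a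
    ... | no _ | yes _ = refl
    ... | no _ | no b≢b = contradiction refl b≢b

    transpose-other : d ≢ a → d ≢ b → transpose a b d ≡ d
    transpose-other {d} {a} {b} d≢a d≢b with d ≟ a | d ≟ b
    ... | yes d≡a | _ = contradiction d≡a d≢a
    ... | no _ | yes d≡b = contradiction d≡b d≢b
    ... | no _ | no _ = refl

    transpose-involutive : ∀ a b d → transpose a b (transpose a b d) ≡ d
    transpose-involutive a b d with d ≟ a | d ≟ b
    ... | yes refl | _ = transpose-b d b
    ... | no _ | yes refl = transpose-a a d
    ... | no d≢a | no d≢b = transpose-other d≢a d≢b

    transpose-preserves : ∀ {B : Set} (f : A → B) → f a ≡ f b → ∀ d → f (transpose a b d) ≡ f d
    transpose-preserves {a} {b} f fa≡fb d with d ≟ a | d ≟ b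
    ... | yes refl | _ = sym fa≡fb
    ... | no _ | yes refl = fa≡fb
    ... | no _ | no _ = refl

    transpose-conj : (f : A → A) → (∀ d → f (f d) ≡ d) →
                     ∀ a b d → f (transpose (f a) (f b) d) ≡ transpose a b (f d)
    transpose-conj f f-involutive a b d with d ≟ f a | d ≟ f b
    ... | yes refl | _ = begin
      f (f b)                  ≡⟨ f-involutive b ⟩
      b                        ≡⟨ transpose-a a b ⟨
      transpose a b a          ≡⟨ cong (transpose a b) (f-involutive a) ⟨
      transpose a b (f (f a))  ∎
    ... | no _ | yes refl = begin
      f (f a)                  ≡⟨ f-involutive a ⟩
      a                        ≡⟨ transpose-b a b ⟨
      transpose a b b          ≡⟨ cong (transpose a b) (f-involutive b) ⟨
      transpose a b (f (f b))  ∎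
    ... | no d≢fa | no d≢fb = sym (transpose-other (d≢fa ∘ flip-eq) (d≢fb ∘ flip-eq))
      where
      flip-eq : ∀ {c} → f d ≡ c → d ≡ f c
      flip-eq refl = sym (f-involutive d)

  transpose-injective : ∀ a b → Injective _≡_ _≡_ (transpose a b)
  transpose-injective a b {c} {d} same = begin
    c                                  ≡⟨ transpose-involutive a b c ⟨
    transpose a b (transpose a b c)    ≡⟨ cong (transpose a b) same ⟩
    transpose a b (transpose a b d)    ≡⟨ transpose-involutive a b d ⟩
    d                                  ∎

  module Transposition (σ σ' : A → A) (σ-inj : Injective _≡_ _≡_ σ) (a b : A)
                       (σ'≗ : ∀ d → σ' d ≡ σ (transpose a b d)) where

    σ'-injective : Injective _≡_ _≡_ σ'
    σ'-injective {c} {d} same = transpose-injective a b (σ-inj (trans (sym (σ'≗ c)) (trans same (σ'≗ d))))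

    σ'-a : σ' a ≡ σ b
    σ'-a = trans (σ'≗ a) (cong σ (transpose-a a b))

    σ'-b : σ' b ≡ σ a
    σ'-b = trans (σ'≗ b) (cong σ (transpose-b a b))

    σ'-other : w ≢ a → w ≢ b → σ' w ≡ σ w
    σ'-other w≢a w≢b = trans (σ'≗ _) (cong σ (transpose-other w≢a w≢b))

    Orb-cover : Orb σ d z → Orb σ' d z ⊎ Orb σ' a z ⊎ Orb σ' b z
    Orb-cover {d} = Orb-invariant (λ w → Orb σ' d w ⊎ Orb σ' a w ⊎ Orb σ' b w) extend (inj₁ Orb-refl)
      where
      extend : Orb σ' d w ⊎ Orb σ' a w ⊎ Orb σ' b w → Orb σ' d (σ w) ⊎ Orb σ' a (σ w) ⊎ Orb σ' b (σ w)
      extend {w} reached with w ≟ a | w ≟ b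
      ... | yes refl | _ = inj₂ (inj₂ (1 , σ'-b))
      ... | no _ | yes refl = inj₂ (inj₁ (1 , σ'-a))
      ... | no w≢a | no w≢b = Sum.map step (Sum.map step step) reached
        where
        step : ∀ {c} → Orb σ' c w → Orb σ' c (σ w)
        step c→w = Orb-trans c→w (1 , σ'-other w≢a w≢b)

    module _ (a↛b : ¬ Orb σ a b) where
      merge-joins : Orb σ' a b
      merge-joins with first-hit (λ w → (w ≟ a) ⊎-dec (w ≟ b)) agree (Orb-sym σ-inj (1 , refl)) (inj₂ refl)
        where
        agree : ∀ {w} → ¬ (w ≡ a ⊎ w ≡ b) → σ' w ≡ σ w
        agree w∉ab = σ'-other (w∉ab ∘ inj₁) (w∉ab ∘ inj₂)
      ... | _ , inj₁ refl , σb→a , _ = contradiction (Orb-sym σ-inj (Orb-trans (1 , refl) σb→a)) a↛b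
      ... | _ , inj₂ refl , _ , σ'-path = Orb-trans (1 , σ'-a) σ'-path

      merge-Orb-⊆ : Orb σ d z → Orb σ' d z
      merge-Orb-⊆ = Orb-lift step
        where
        step : ∀ w → Orb σ' w (σ w)
        step w with w ≟ a | w ≟ b
        ... | yes refl | _ = Orb-trans merge-joins (1 , σ'-b)
        ... | no _ | yes refl = Orb-trans (Orb-sym σ'-injective merge-joins) (1 , σ'-a)
        ... | no w≢a | no w≢b = 1 , σ'-other w≢a w≢b

      lost-least : ∃ λ r → isLeast σ r ≡ true × isLeast σ' r ≡ false
      lost-least with least-exists {σ} a | least-exists {σ} b
      ... | ra , a→ra , ra-least | rb , b→rb , rb-least
          with isLeast σ' ra in ra-least' | isLeast σ' rb in rb-least'
      ...   | false | _ = ra , ra-least , ra-least'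
      ...   | true | false = rb , rb-least , rb-least'
      ...   | true | true = contradiction a→b a↛b
        where
        ra≡rb : ra ≡ rb
        ra≡rb = least-unique σ'-injective ra-least' rb-least'
                  (Orb-meet σ'-injective (merge-Orb-⊆ a→ra) (Orb-trans merge-joins (merge-Orb-⊆ b→rb)))
        a→b : Orb σ a b
        a→b = Orb-trans a→ra (subst (λ r → Orb σ r b) (sym ra≡rb) (Orb-sym σ-inj b→rb))

      merge-count : orbitCount σ' < orbitCount σ
      merge-count with lost-least
      ... | r , least , not-least' = countTrue-< least'⇒least (∈-elements r) not-least' least
        where
        least'⇒least : ∀ {w} → isLeast σ' w ≡ true → isLeast σ w ≡ true
        least'⇒least least' = least-intro (least-≤ σ'-injective least' ∘ merge-Orb-⊆)

    module _ (a→b : Orb σ a b) where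
      split-Orb-⊆ : Orb σ' d z → Orb σ d z
      split-Orb-⊆ = Orb-lift step
        where
        step : ∀ w → Orb σ w (σ' w)
        step w with w ≟ a | w ≟ b
        ... | yes refl | _ = Orb-trans a→b (1 , sym σ'-a)
        ... | no _ | yes refl = Orb-trans (Orb-sym σ-inj a→b) (1 , sym σ'-b)
        ... | no w≢a | no w≢b = 1 , sym (σ'-other w≢a w≢b)

      New : A → Set
      New w = isLeast σ' w ≡ true × isLeast σ w ≡ false

      classify : isLeast σ' w ≡ true → isLeast σ w ≡ true ⊎ New w
      classify {w} least' with isLeast σ w
      ... | true = inj₁ refl
      ... | false = inj₂ (least' , refl)

      new-in-orbit : New w → Orb σ a w
      new-in-orbit {w} (least' , not-least) with Orb? σ-inj a w
      ... | yes a→w = a→w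
      ... | no a↛w = contradiction (trans (sym (least-intro lower)) not-least) λ ()
        where
        lower : ∀ {z} → Orb σ w z → key w ≤ key z
        lower w→z with Orb-cover w→z
        ... | inj₁ w→z' = least-≤ σ'-injective least' w→z'
        ... | inj₂ (inj₁ a→z') = contradiction (Orb-trans (split-Orb-⊆ a→z') (Orb-sym σ-inj w→z)) a↛w
        ... | inj₂ (inj₂ b→z') =
          contradiction (Orb-trans a→b (Orb-trans (split-Orb-⊆ b→z') (Orb-sym σ-inj w→z))) a↛w

      two-classes : ∀ {u v} → Orb σ a u → Orb σ a v → ¬ Orb σ' u v → Orb σ a w → Orb σ' w u ⊎ Orb σ' w v
      two-classes a→u a→v u↛v a→w with side a→u | side a→v | side a→w
        where
        side : ∀ {w} → Orb σ a w → Orb σ' a w ⊎ Orb σ' b w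
        side = [ inj₁ , id ]′ ∘ Orb-cover
      ... | inj₁ a→u | inj₁ a→v | _ = contradiction (Orb-meet σ'-injective a→u a→v) u↛v
      ... | inj₂ b→u | inj₂ b→v | _ = contradiction (Orb-meet σ'-injective b→u b→v) u↛v
      ... | inj₁ a→u | inj₂ _ | inj₁ a→w = inj₁ (Orb-meet σ'-injective a→w a→u)
      ... | inj₁ _ | inj₂ b→v | inj₂ b→w = inj₂ (Orb-meet σ'-injective b→w b→v)
      ... | inj₂ b→u | inj₁ _ | inj₂ b→w = inj₁ (Orb-meet σ'-injective b→w b→u)
      ... | inj₂ _ | inj₁ a→v | inj₁ a→w = inj₂ (Orb-meet σ'-injective a→w a→v)

      -- The σ-cycle of a is the union of the σ'-cycles of u and v. It has elements below u,
      -- as u is not σ-least; they avoid the σ'-cycle of u, so they lie above v.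
      new-below : ∀ {u v} → New u → New v → ¬ Orb σ' u v → key v < key u
      new-below new-u@(u-least' , u-not-least) new-v@(v-least' , _) u↛v with smaller-in-orbit u-not-least
      ... | z , u→z , z<u
          with two-classes (new-in-orbit new-u) (new-in-orbit new-v) u↛v (Orb-trans (new-in-orbit new-u) u→z)
      ...   | inj₁ z→u = contradiction (least-≤ σ'-injective u-least' (Orb-sym σ'-injective z→u)) (<⇒≱ z<u)
      ...   | inj₂ z→v = ≤-<-trans (least-≤ σ'-injective v-least' (Orb-sym σ'-injective z→v)) z<u

      new-unique : ∀ {u v} → New u → New v → u ≡ v
      new-unique {u} {v} new-u new-v with Orb? σ'-injective u v
      ... | yes u→v = least-unique σ'-injective (proj₁ new-u) (proj₁ new-v) u→v
      ... | no u↛v =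
        contradiction (new-below new-u new-v u↛v) (<-asym (new-below new-v new-u (u↛v ∘ Orb-sym σ'-injective)))

      split-count : orbitCount σ' ≤ suc (orbitCount σ)
      split-count = countTrue-≤-suc elements-unique classify new-unique

    count-≤-suc : orbitCount σ' ≤ suc (orbitCount σ)
    count-≤-suc with Orb? σ-inj a b
    ... | yes a→b = split-count a→b
    ... | no a↛b = m≤n⇒m≤1+n (<⇒≤ (merge-count a↛b))

bitFin : Bool → Fin 2
bitFin false = fzero
bitFin true = fsuc fzero

bitFin-injective : Injective _≡_ _≡_ bitFin
bitFin-injective {false} {false} _ = refl
bitFin-injective {true} {true} _ = refl

key≡toℕ-combine : ∀ {G} (d : Dart G) → key {G} d ≡ toℕ (combine (proj₁ d) (bitFin (proj₂ d)))
key≡toℕ-combine (e , false) = sym (toℕ-combine e fzero)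
key≡toℕ-combine (e , true) = sym (toℕ-combine e (fsuc fzero))

key-injective : ∀ G → Injective _≡_ _≡_ (key {G})
key-injective G {e , b} {e' , b'} same
  with combine-injective e (bitFin b) e' (bitFin b') (toℕ-injective (begin
         toℕ (combine e (bitFin b))    ≡⟨ key≡toℕ-combine {G} (e , b) ⟨
         key {G} (e , b)               ≡⟨ same ⟩
         key {G} (e' , b')             ≡⟨ key≡toℕ-combine {G} (e' , b') ⟩
         toℕ (combine e' (bitFin b'))  ∎))
  where open ≡-Reasoning
... | refl , same-bit with bitFin-injective same-bit
...   | refl = refl

key<2E : ∀ G (d : Dart G) → key {G} d < 2 * E G
key<2E G d =
  ≤-<-trans (≤-reflexive (key≡toℕ-combine {G} d)) (<-≤-trans (toℕ<n _) (≤-reflexive (*-comm (E G) 2)))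

bothDarts : ∀ {n} → Fin n → List (Fin n × Bool)
bothDarts e = (e , false) ∷ (e , true) ∷ []

module _ {n : ℕ} where
  private variable
    e : Fin n
    es : List (Fin n)

  ∈-concatMap-bothDarts⁺ : ∀ b → e ∈ es → (e , b) ∈ concatMap bothDarts es
  ∈-concatMap-bothDarts⁺ false (here refl) = here refl
  ∈-concatMap-bothDarts⁺ true (here refl) = there (here refl)
  ∈-concatMap-bothDarts⁺ b (there e∈) = there (there (∈-concatMap-bothDarts⁺ b e∈))

  ∈-concatMap-bothDarts⁻ : ∀ {d} → d ∈ concatMap bothDarts es → proj₁ d ∈ es
  ∈-concatMap-bothDarts⁻ {es = _ ∷ _} (here refl) = here refl
  ∈-concatMap-bothDarts⁻ {es = _ ∷ _} (there (here refl)) = here refl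
  ∈-concatMap-bothDarts⁻ {es = _ ∷ _} (there (there d∈)) = there (∈-concatMap-bothDarts⁻ d∈)

  unique-concatMap-bothDarts : Unique es → Unique (concatMap bothDarts es)
  unique-concatMap-bothDarts [] = []
  unique-concatMap-bothDarts {es = e ∷ es} (e∉es ∷ unique) =
    ((λ ()) ∷ others) ∷ others ∷ unique-concatMap-bothDarts unique
    where
    others : ∀ {b} → All ((e , b) ≢_) (concatMap bothDarts es)
    others = All.tabulate (λ d∈ same → All.lookup e∉es (∈-concatMap-bothDarts⁻ d∈) (cong proj₁ same))

allDarts-complete : ∀ G (d : Dart G) → d ∈ allDarts G
allDarts-complete G (e , b) = ∈-concatMap-bothDarts⁺ b (∈-allFin e)

allDarts-unique : ∀ G → Unique (allDarts G)
allDarts-unique G = unique-concatMap-bothDarts (allFin⁺ (E G))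

-- Here isLeast (φ R) is Defs.isRep R, so orbitCount (φ R) is faces R as soon as E G ≢ 0.
module DartOrbits (G : Graph) =
  FiniteOrbits (key {G}) (2 * E G) (key<2E G) (key-injective G)
               (allDarts G) (allDarts-complete G) (allDarts-unique G)

θ-involutive : ∀ G (d : Dart G) → θ G (θ G d) ≡ d
θ-involutive G (e , b) = cong (e ,_) (not-involutive b)

module _ {G : Graph} where
  ρ-injective : (R : RotationSystem G) → Injective _≡_ _≡_ (ρ R)
  ρ-injective R {c} {d} same = trans (sym (inv₂ R c)) (trans (cong (ρ⁻¹ R) same) (inv₂ R d))

  φ-injective : (R : RotationSystem G) → Injective _≡_ _≡_ (φ R)
  φ-injective R {c} {d} same =
    trans (sym (θ-involutive G c)) (trans (cong (θ G) (ρ-injective R same)) (θ-involutive G d))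

-- ρ' = ρ ∘ (p x) ∘ (y x) takes x out of the rotation at its vertex (ρ ∘ (p x) fixes x)
-- and puts it back between y and ρ y.
module Reinsert {G : Graph} (R : RotationSystem G) (x y : Dart G)
                (y-at-x : tail G y ≡ tail G x) (y≢x : y ≢ x) where
  open DartOrbits G
  open ≡-Reasoning

  p : Dart G
  p = ρ⁻¹ R x

  ρ₀ ρ' : Dart G → Dart G
  ρ₀ = ρ R ∘ transpose p x
  ρ' = ρ₀ ∘ transpose y x

  module Remove = Transposition (ρ R) ρ₀ (ρ-injective R) p x (λ _ → refl)
  module Insert = Transposition ρ₀ ρ' Remove.σ'-injective y x (λ _ → refl)

  p-at-x : tail G p ≡ tail G x
  p-at-x = trans (sym (ρ-tail R p)) (cong (tail G) (inv₁ R x))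

  ρ₀-tail : ∀ d → tail G (ρ₀ d) ≡ tail G d
  ρ₀-tail d = trans (ρ-tail R _) (transpose-preserves (tail G) p-at-x d)

  ρ'-tail : ∀ d → tail G (ρ' d) ≡ tail G d
  ρ'-tail d = trans (ρ₀-tail _) (transpose-preserves (tail G) y-at-x d)

  x-fixed : ρ₀ x ≡ x
  x-fixed = trans (cong (ρ R) (transpose-b p x)) (inv₁ R x)

  y↛x : ¬ Orb ρ₀ y x
  y↛x = y≢x ∘ Orb-fixedPoint Remove.σ'-injective x-fixed

  y→x : Orb ρ' y x
  y→x = Insert.merge-joins y↛x

  ρ₀⊆ρ' : ∀ {d z} → Orb ρ₀ d z → Orb ρ' d z
  ρ₀⊆ρ' = Insert.merge-Orb-⊆ y↛x

  p→y : Orb ρ₀ p y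
  p→y = [ id , [ id , (λ x→y → ⊥-elim (y↛x (Orb-sym Remove.σ'-injective x→y))) ]′ ]′
          (Remove.Orb-cover (ρ-trans R p y (trans p-at-x (sym y-at-x))))

  x→p : Orb ρ' x p
  x→p = Orb-sym Insert.σ'-injective (Orb-trans (ρ₀⊆ρ' p→y) y→x)

  x→vertex : ∀ {w} → tail G w ≡ tail G x → Orb ρ' x w
  x→vertex w-at-x =
    [ from-p , [ from-p , ρ₀⊆ρ' ]′ ]′ (Remove.Orb-cover (ρ-trans R p _ (trans p-at-x (sym w-at-x))))
    where
    from-p : ∀ {w} → Orb ρ₀ p w → Orb ρ' x w
    from-p p→w = Orb-trans x→p (ρ₀⊆ρ' p→w)

  ρ'-trans : ∀ d d' → tail G d ≡ tail G d' → Orb ρ' d d'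
  ρ'-trans d d' same-vertex with Remove.Orb-cover (ρ-trans R d d' same-vertex)
  ... | inj₁ d→d' = ρ₀⊆ρ' d→d'
  ... | inj₂ from-p-or-x =
    Orb-meet Insert.σ'-injective (x→vertex (trans same-vertex d'-at-x)) (x→vertex d'-at-x)
    where
    d'-at-x : tail G d' ≡ tail G x
    d'-at-x = [ (λ p→d' → trans (Orb-preserves (tail G) ρ₀-tail p→d') p-at-x)
              , Orb-preserves (tail G) ρ₀-tail ]′ from-p-or-x


  ρ'⁻¹ : Dart G → Dart G
  ρ'⁻¹ = transpose y x ∘ transpose p x ∘ ρ⁻¹ R

  ρ'-ρ'⁻¹ : ∀ d → ρ' (ρ'⁻¹ d) ≡ d
  ρ'-ρ'⁻¹ d = begin
    ρ R (transpose p x (transpose y x (transpose y x (transpose p x (ρ⁻¹ R d)))))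
      ≡⟨ cong (ρ R ∘ transpose p x) (transpose-involutive y x _) ⟩
    ρ R (transpose p x (transpose p x (ρ⁻¹ R d)))
      ≡⟨ cong (ρ R) (transpose-involutive p x _) ⟩
    ρ R (ρ⁻¹ R d)
      ≡⟨ inv₁ R d ⟩
    d ∎

  ρ'⁻¹-ρ' : ∀ d → ρ'⁻¹ (ρ' d) ≡ d
  ρ'⁻¹-ρ' d = begin
    transpose y x (transpose p x (ρ⁻¹ R (ρ R (transpose p x (transpose y x d)))))
      ≡⟨ cong (transpose y x ∘ transpose p x) (inv₂ R _) ⟩
    transpose y x (transpose p x (transpose p x (transpose y x d)))
      ≡⟨ cong (transpose y x) (transpose-involutive p x _) ⟩
    transpose y x (transpose y x d)
      ≡⟨ transpose-involutive y x d ⟩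
    d ∎

  rotation : RotationSystem G
  rotation = record
    { ρ = ρ' ; ρ⁻¹ = ρ'⁻¹ ; inv₁ = ρ'-ρ'⁻¹ ; inv₂ = ρ'⁻¹-ρ' ; ρ-tail = ρ'-tail ; ρ-trans = ρ'-trans }

module _ {G : Graph} where
  OnFace : RotationSystem G → Dart G → Fin (E G) → Set
  OnFace R d₀ e = ∃ λ b → Orb (φ R) d₀ (e , b)

  Touches : RotationSystem G → Dart G → Fin (V G) → Set
  Touches R d₀ v = ∃ λ z → Orb (φ R) d₀ z × tail G z ≡ v

  record Frontier (R : RotationSystem G) (d₀ : Dart G) : Set where
    field
      z x        : Dart G
      z-on-face  : Orb (φ R) d₀ z
      z-at-x     : tail G z ≡ tail G x
      x-off-face : ¬ OnFace R d₀ (proj₁ x)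

module GrowFace {G : Graph} {R : RotationSystem G} {d₀ : Dart G} (frontier : Frontier R d₀) where
  open DartOrbits G
  open Frontier frontier
  open Equivalence using (to; from)
  open ≡-Reasoning

  y p : Dart G
  y = ρ⁻¹ R z
  p = ρ⁻¹ R x

  θy-on-face : Orb (φ R) d₀ (θ G y)
  θy-on-face =
    Orb-trans z-on-face (Orb-sym (φ-injective R) (1 , trans (cong (ρ R) (θ-involutive G y)) (inv₁ R z)))

  x-off : ¬ Orb (φ R) d₀ x
  x-off x-on = x-off-face (proj₂ x , x-on)

  θx-off : ¬ Orb (φ R) d₀ (θ G x)
  θx-off θx-on = x-off-face (not (proj₂ x) , θx-on)

  θp-off : ¬ Orb (φ R) d₀ (θ G p)
  θp-off θp-on = x-off (Orb-trans θp-on (1 , trans (cong (ρ R) (θ-involutive G p)) (inv₁ R x)))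

  y-at-x : tail G y ≡ tail G x
  y-at-x = trans (sym (ρ-tail R y)) (trans (cong (tail G) (inv₁ R z)) z-at-x)

  y≢x : y ≢ x
  y≢x refl = θx-off θy-on-face

  R' : RotationSystem G
  R' = Reinsert.rotation R x y y-at-x y≢x

  φ₀ : Dart G → Dart G
  φ₀ = φ R ∘ transpose (θ G p) (θ G x)

  φ'≗ : ∀ d → φ R' d ≡ φ₀ (transpose (θ G y) (θ G x) d)
  φ'≗ d = cong (ρ R) (begin
    transpose p x (transpose y x (θ G d))                         ≡⟨ cong (transpose p x) (θ-conj y x d) ⟨
    transpose p x (θ G (transpose (θ G y) (θ G x) d))             ≡⟨ θ-conj p x _ ⟨
    θ G (transpose (θ G p) (θ G x) (transpose (θ G y) (θ G x) d)) ∎)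
    where
    θ-conj : ∀ a b d → θ G (transpose (θ G a) (θ G b) d) ≡ transpose a b (θ G d)
    θ-conj = transpose-conj (θ G) (θ-involutive G)

  module Detach = Transposition (φ R) φ₀ (φ-injective R) (θ G p) (θ G x) (λ _ → refl)
  module Attach = Transposition φ₀ (φ R') Detach.σ'-injective (θ G y) (θ G x) φ'≗

  face-unchanged : ∀ {w} → Orb (φ R) d₀ w ⇔ Orb φ₀ d₀ w
  face-unchanged = Orb-agree λ w-on → Detach.σ'-other (λ { refl → θp-off w-on }) (λ { refl → θx-off w-on })

  θy↛θx : ¬ Orb φ₀ (θ G y) (θ G x)
  θy↛θx θy→θx = θx-off (from face-unchanged (Orb-trans (to face-unchanged θy-on-face) θy→θx))

  fewer-faces : orbitCount (φ R') ≤ orbitCount (φ R)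
  fewer-faces = s≤s⁻¹ (≤-trans (Attach.merge-count θy↛θx) Detach.count-≤-suc)

  face-grows : ∀ {w} → Orb (φ R) d₀ w → Orb (φ R') d₀ w
  face-grows = Attach.merge-Orb-⊆ θy↛θx ∘ to face-unchanged

  x-on-new-face : OnFace R' d₀ (proj₁ x)
  x-on-new-face = not (proj₂ x) , Orb-trans (face-grows θy-on-face) (Attach.merge-joins θy↛θx)

does-true : ∀ {P : Set} (P? : Dec P) → does P? ≡ true → P
does-true (yes P) _ = P

module Saturate (G : Graph) (connected : ∀ u v → Reach G u v) (d₀ : Dart G) where
  open DartOrbits G

  onFace? : ∀ (R : RotationSystem G) e → Dec (OnFace R d₀ e)
  onFace? R e = map′ (λ { (inj₁ on) → false , on ; (inj₂ on) → true , on })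
                     (λ { (false , on) → inj₁ on ; (true , on) → inj₂ on })
                     (Orb? (φ-injective R) d₀ (e , false) ⊎-dec Orb? (φ-injective R) d₀ (e , true))

  edgesOnFace : RotationSystem G → ℕ
  edgesOnFace R = countTrue (λ e → does (onFace? R e)) (allFin (E G))

  edgesOnFace≤E : ∀ (R : RotationSystem G) → edgesOnFace R ≤ E G
  edgesOnFace≤E R = ≤-trans (countTrue≤length (allFin (E G))) (≤-reflexive (length-tabulate id))

  frontier-at : ∀ {R : RotationSystem G} {x} → Touches R d₀ (tail G x) → ¬ OnFace R d₀ (proj₁ x) → Frontier R d₀
  frontier-at {x = x} (z , z-on , z-at) x-off =
    record { z = z ; x = x ; z-on-face = z-on ; z-at-x = z-at ; x-off-face = x-off }

  cross-edge : ∀ (R : RotationSystem G) e b → Touches R d₀ (tail G (e , b)) →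
               Touches R d₀ (tail G (e , not b)) ⊎ Frontier R d₀
  cross-edge R e b touches with onFace? R e
  ... | no off = inj₂ (frontier-at {x = e , b} touches off)
  ... | yes (c , on) = inj₁ (other-end b c on)
    where
    touches-opposite : ∀ {d} → Orb (φ R) d₀ d → Touches R d₀ (tail G (θ G d))
    touches-opposite {d} on = φ R d , Orb-trans on (1 , refl) , ρ-tail R (θ G d)
    other-end : ∀ b c → Orb (φ R) d₀ (e , c) → Touches R d₀ (tail G (e , not b))
    other-end false false on = touches-opposite on
    other-end false true on = _ , on , refl
    other-end true false on = _ , on , refl
    other-end true true on = touches-opposite on

  touched-or-frontier : ∀ (R : RotationSystem G) {v} → Reach G (tail G d₀) v → Touches R d₀ v ⊎ Frontier R d₀
  touched-or-frontier R here = inj₁ (d₀ , Orb-refl , refl)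
  touched-or-frontier R (fwd e r) = [ cross-edge R e false , inj₂ ]′ (touched-or-frontier R r)
  touched-or-frontier R (bwd e r) = [ cross-edge R e true , inj₂ ]′ (touched-or-frontier R r)

  frontier-of-missing : ∀ (R : RotationSystem G) {e} → ¬ OnFace R d₀ e → Frontier R d₀
  frontier-of-missing R {e} off =
    [ (λ touches → frontier-at {x = e , false} touches off) , id ]′ (touched-or-frontier R (connected _ _))

  Improvement : RotationSystem G → Set
  Improvement R =
    ∃ λ (R' : RotationSystem G) → orbitCount (φ R') ≤ orbitCount (φ R) × edgesOnFace R < edgesOnFace R'

  grow : ∀ (R : RotationSystem G) → Frontier R d₀ → Improvement R
  grow R frontier = R' , fewer-faces , countTrue-< on⇒on' (∈-allFin (proj₁ x))
    (dec-false (onFace? R _) x-off-face) (dec-true (onFace? R' _) x-on-new-face)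
    where
    open GrowFace frontier
    open Frontier frontier using (x; x-off-face)
    on⇒on' : ∀ {e} → does (onFace? R e) ≡ true → does (onFace? R' e) ≡ true
    on⇒on' {e} on with does-true (onFace? R e) on
    ... | b , on-face = dec-true (onFace? R' e) (b , face-grows on-face)

  all-on-or-frontier : ∀ (R : RotationSystem G) → (∀ e → OnFace R d₀ e) ⊎ Frontier R d₀
  all-on-or-frontier R with any? (λ e → ¬? (onFace? R e))
  ... | no none-off = inj₁ (λ e → decidable-stable (onFace? R e) (none-off ∘ (e ,_)))
  ... | yes (e , off) = inj₂ (frontier-of-missing R off)

  Saturated : RotationSystem G → Set
  Saturated R = ∃ λ (R' : RotationSystem G) → (∀ e → OnFace R' d₀ e) × orbitCount (φ R') ≤ orbitCount (φ R)

  saturate : ∀ n (R : RotationSystem G) → E G ≤ n + edgesOnFace R → Saturated R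
  saturate n R enough =
    [ (λ all-on → R , all-on , ≤-refl) , continue n enough ∘ grow R ]′ (all-on-or-frontier R)
    where
    continue : ∀ n → E G ≤ n + edgesOnFace R → Improvement R → Saturated R
    continue zero enough (R' , _ , more) = contradiction (≤-trans more (edgesOnFace≤E R')) (≤⇒≯ enough)
    continue (suc n) enough (R' , fewer , more) with saturate n R' (begin
      E G                         ≤⟨ enough ⟩
      suc n + edgesOnFace R       ≡⟨ +-suc n (edgesOnFace R) ⟨
      n + suc (edgesOnFace R)     ≤⟨ +-monoʳ-≤ n more ⟩
      n + edgesOnFace R'          ∎)
      where open ≤-Reasoning
    ... | R'' , all-on , fewer' = R'' , all-on , ≤-trans fewer' fewer

genus-antitone : ∀ {G : Graph} (R R' : RotationSystem G) → faces R' ≤ faces R → genus R ≤ genus R'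
genus-antitone {G} R R' fewer = /-monoˡ-≤ 2 (∸-monoʳ-≤ (2 + E G) (+-monoʳ-≤ (V G) fewer))

corollary2p2 : (G : Graph) → Connected G → (g : ℕ) → IsMaxGenus G g →
    ∃ λ (R : RotationSystem G) → HasFaceWithAllEdges R × genus R ≡ g
corollary2p2 record { E = zero } _ _ ((R , genus≡g) , _) = R , inj₁ refl , genus≡g
corollary2p2 G@record { E = suc m } (_ , connected) g ((R , genus≡g) , maximal) =
  let R' , all-on , fewer-faces = Saturate.saturate G connected (fzero , false) (suc m) R (m≤m+n (suc m) _)
      g≤genus : g ≤ genus R'
      g≤genus = subst (_≤ genus R') genus≡g (genus-antitone R R' fewer-faces)
  in  R' , inj₂ (_ , all-on) , ≤-antisym (maximal R') g≤genus
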